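{- Fix a finite request sequence $\sigma$ and let $\mathrm{OPT}^*$ be the optimal offline algorithm defined in the context. Let $P=\langle\sigma_i,\sigma_{i+1},\dots,\sigma_j\rangle$ be a phase of $\mathrm{OPT}^*$ that is not the first phase of $\sigma$, and let $x$ be the pivot of $\mathrm{OPT}^*$ during $P$. Then $x\in\sigma_i$.
   Context: Problem: The host graph is a star on $n$ physical hosts: one central host at distance $1$ from every other host, and any two distinct non-central hosts at distance $2$. A set $X$ of $n$ guest nodes is mapped bijectively to the hosts; the guest node on the central host is the central node. From a given initial configuration, requests $\sigma_1,\sigma_2,\dots$ (each a pair of distinct guest nodes) must be served in order at cost equal to the host distance between the two requested nodes in the current configuration (cost $1$ if one is the central node, $2$ otherwise); at any time an algorithm may migrate a guest node to the center (swap with the current central node) at cost $1$. Total cost = serving + migration cost. A phase of an algorithm is a (maximal) set of consecutive requests during which the algorithm keeps the same central node; the pivot of the algorithm at a time is its central node at that time. $\mathrm{OPT}^*$ is an optimal (minimum total cost) offline algorithm on $\sigma$ which, among all optimal offline algorithms, minimizes the lexicographic order of the reversed sequence of its phase lengths (i.e. first minimizes the length of the last phase, then of the penultimate phase, and so on), ties broken arbitrarily. -}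

module Defs where

open import Data.Nat using (ℕ; zero; suc; _+_; _≤_; _<_)
open import Data.Fin using (Fin; toℕ)
open import Data.Fin.Properties using (_≟_)
open import Data.Vec using (Vec; []; _∷_; lookup; toList)
open import Data.List using (List; []; _∷_; reverse)
open import Data.Product using (Σ; _×_; _,_; proj₁; proj₂)
open import Data.Sum using (_⊎_)
open import Relation.Nullary using (yes; no; ¬_)
open import Relation.Binary.PropositionalEquality using (_≡_; _≢_)

-- A request is a pair of distinct guest nodes (guest nodes = Fin n).
Request : ℕ → Set
Request n = Σ (Fin n × Fin n) (λ r → proj₁ r ≢ proj₂ r)

-- Cost of serving request r when c is the central node (pivot):
-- host distance 1 if c is one of the requested nodes, 2 otherwise.
serveCost : ∀ {n} → Fin n → Request n → ℕ
serveCost c ((a , b) , _) with c ≟ a | c ≟ b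
... | yes _ | _     = 1
... | no _  | yes _ = 1
... | no _  | no _  = 2

-- Migration cost between consecutive pivots: one swap with the center (cost 1)
-- iff the pivot changes.
migCost : ∀ {n} → Fin n → Fin n → ℕ
migCost c d with c ≟ d
... | yes _ = 0
... | no _  = 1

-- An algorithm on a request sequence of length m is described by its pivot
-- while serving each request.  cost prev pivots σ = total cost starting with
-- central node prev.
cost : ∀ {n m} → Fin n → Vec (Fin n) m → Vec (Request n) m → ℕ
cost prev []       []       = 0
cost prev (p ∷ ps) (r ∷ rs) = migCost prev p + serveCost p r + cost p ps rs

runsFrom : ∀ {n} → Fin n → ℕ → List (Fin n) → List ℕ
runsFrom x k []       = k ∷ []
runsFrom x k (y ∷ ys) with x ≟ y
... | yes _ = runsFrom x (suc k) ys
... | no _  = k ∷ runsFrom y 1 ys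

runs : ∀ {n} → List (Fin n) → List ℕ
runs []       = []
runs (x ∷ xs) = runsFrom x 1 xs

phaseLengths : ∀ {n m} → Vec (Fin n) m → List ℕ
phaseLengths ps = runs (toList ps)

data _≤lex_ : List ℕ → List ℕ → Set where
  []≤    : ∀ {ys} → [] ≤lex ys
  head<  : ∀ {x y xs ys} → x < y → (x ∷ xs) ≤lex (y ∷ ys)
  head≡  : ∀ {x xs ys} → xs ≤lex ys → (x ∷ xs) ≤lex (x ∷ ys)

IsOptimal : ∀ {n m} → Fin n → Vec (Request n) m → Vec (Fin n) m → Set
IsOptimal init σ ps = ∀ qs → cost init ps σ ≤ cost init qs σ

IsOPTstar : ∀ {n m} → Fin n → Vec (Request n) m → Vec (Fin n) m → Set
IsOPTstar init σ ps =
  IsOptimal init σ ps ×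
  (∀ qs → IsOptimal init σ qs →
     reverse (phaseLengths ps) ≤lex reverse (phaseLengths qs))

-- ⟨σ_i,…,σ_j⟩ (0-based indices) is a phase of the algorithm with pivots ps:
-- the pivot is constant on [i,j] and the run is maximal on both sides.
IsPhase : ∀ {n m} → Vec (Fin n) m → Fin m → Fin m → Set
IsPhase {m = m} ps i j =
  toℕ i ≤ toℕ j ×
  (∀ (k : Fin m) → toℕ i ≤ toℕ k → toℕ k ≤ toℕ j → lookup ps k ≡ lookup ps i) ×
  (∀ (k : Fin m) → suc (toℕ k) ≡ toℕ i → lookup ps k ≢ lookup ps i) ×
  (∀ (k : Fin m) → toℕ k ≡ suc (toℕ j) → lookup ps k ≢ lookup ps j)

_∈ʳ_ : ∀ {n} → Fin n → Request n → Set
x ∈ʳ ((a , b) , _) = x ≡ a ⊎ x ≡ b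

{-# OPTIONS --safe #-}

-- Let y ≠ x be the pivots just before and at the start i of the phase, and suppose x ∉ σᵢ.
-- Postponing the switch, i.e. serving σᵢ with y and migrating to x only afterwards, saves
-- the migration before σᵢ, cannot make σᵢ dearer (it already costs 2), and costs at most
-- one migration after it.  So the total cost does not increase, and it strictly decreases
-- unless x is also the pivot at i + 1.  In that case the modified algorithm is optimal,
-- its phase P is one shorter and the preceding phase one longer, so its reversed sequence
-- of phase lengths is lexicographically smaller, contradicting the choice of OPT*.

module Submission where

open import Defs
open import Data.Nat using (ℕ)
open import Data.Fin using (Fin; toℕ)
open import Data.Vec using (Vec; lookup)
open import Relation.Binary.PropositionalEquality using (_≢_)

open import Data.Nat using (zero; suc; _+_; _≤_; _<_; z≤n; s≤s)
open import Data.Nat.Properties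
  using (+-assoc; +-identityʳ; +-suc; +-monoˡ-≤; +-monoʳ-≤; +-monoʳ-<; ≤-refl; ≤-trans; ≤-<-trans;
         <⇒≱; <-irrefl; <-asym; suc-injective)
open import Data.Fin using (zero; suc; inject₁)
open import Data.Fin.Properties using (_≟_; toℕ-inject₁)
open import Data.Vec using ([]; _∷_; toList; _[_]≔_)
open import Data.Vec.Properties using ([]≔-lookup)
open import Data.List using (List; []; _∷_; _++_; [_]; reverse; length)
open import Data.List.Properties using (++-ʳ++; ʳ++-defn)
open import Data.Product using (Σ; ∃₂; _×_; _,_) renaming (map to ×-map)
open import Data.Sum using (_⊎_; inj₁; inj₂; [_,_]′) renaming (map to ⊎-map)
open import Data.Empty using (⊥-elim)
open import Relation.Nullary using (yes; no; ¬_)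
open import Relation.Binary.PropositionalEquality
  using (_≡_; refl; sym; trans; cong; subst₂; module ≡-Reasoning)

private variable
  A : Set
  n m : ℕ

migCost-refl : (x : Fin n) → migCost x x ≡ 0
migCost-refl x with x ≟ x
... | yes _ = refl
... | no x≢x = ⊥-elim (x≢x refl)

migCost-≢ : {x y : Fin n} → x ≢ y → migCost x y ≡ 1
migCost-≢ {x = x} {y} x≢y with x ≟ y
... | yes x≡y = ⊥-elim (x≢y x≡y)
... | no _ = refl

migCost≤1 : (x y : Fin n) → migCost x y ≤ 1
migCost≤1 x y with x ≟ y
... | yes _ = z≤n
... | no _ = s≤s z≤n

serveCost≤2 : (x : Fin n) (r : Request n) → serveCost x r ≤ 2
serveCost≤2 x ((a , b) , _) with x ≟ a | x ≟ b
... | yes _ | _ = s≤s z≤n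
... | no _ | yes _ = s≤s z≤n
... | no _ | no _ = ≤-refl

∈ʳ⊎serveCost≡2 : (x : Fin n) (r : Request n) → x ∈ʳ r ⊎ serveCost x r ≡ 2
∈ʳ⊎serveCost≡2 x ((a , b) , _) with x ≟ a | x ≟ b
... | yes x≡a | _ = inj₁ (inj₁ x≡a)
... | no _ | yes x≡b = inj₁ (inj₂ x≡b)
... | no _ | no _ = inj₂ refl

-- Only meaningful for lists of equal length: the surplus of the longer list is ignored.
listCost : Fin n → List (Fin n) → List (Request n) → ℕ
listCost p (q ∷ qs) (r ∷ rs) = migCost p q + serveCost q r + listCost q qs rs
listCost p _ _ = 0

cost≡listCost : (p : Fin n) (ps : Vec (Fin n) m) (σ : Vec (Request n) m) →
                cost p ps σ ≡ listCost p (toList ps) (toList σ)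
cost≡listCost p [] [] = refl
cost≡listCost p (q ∷ ps) (r ∷ σ) = cong (migCost p q + serveCost q r +_) (cost≡listCost q ps σ)

listCost-++-∷ : (p : Fin n) {ps : List (Fin n)} {σ : List (Request n)} → length ps ≡ length σ →
                (y : Fin n) (s : Request n) (qs : List (Fin n)) (τ : List (Request n)) →
                listCost p (ps ++ y ∷ qs) (σ ++ s ∷ τ)
                  ≡ listCost p (ps ++ [ y ]) (σ ++ [ s ]) + listCost y qs τ
listCost-++-∷ p {[]} {[]} _ y s qs τ = cong (_+ listCost y qs τ) (sym (+-identityʳ _))
listCost-++-∷ p {q ∷ ps} {r ∷ σ} eq y s qs τ = begin
  here + listCost q (ps ++ y ∷ qs) (σ ++ s ∷ τ)
    ≡⟨ cong (here +_) (listCost-++-∷ q {ps} {σ} (suc-injective eq) y s qs τ) ⟩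
  here + (listCost q (ps ++ [ y ]) (σ ++ [ s ]) + listCost y qs τ)
    ≡⟨ sym (+-assoc here _ _) ⟩
  here + listCost q (ps ++ [ y ]) (σ ++ [ s ]) + listCost y qs τ ∎
  where
  open ≡-Reasoning
  here = migCost p q + serveCost q r

listCost-start-≤ : (x y : Fin n) (ps : List (Fin n)) (σ : List (Request n)) →
                   listCost x ps σ ≤ 1 + listCost y ps σ
listCost-start-≤ x y [] σ = z≤n
listCost-start-≤ x y (q ∷ ps) [] = z≤n
listCost-start-≤ x y (q ∷ ps) (r ∷ σ) =
  +-monoˡ-≤ (listCost q ps σ) (+-monoˡ-≤ (serveCost q r) (≤-trans (migCost≤1 x q) (s≤s z≤n)))

listCost-start-<⊎continues : (x y : Fin n) (ps : List (Fin n)) (σ : List (Request n)) →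
                             listCost x ps σ < 1 + listCost y ps σ
                             ⊎ Σ (List (Fin n)) (λ qs → ps ≡ y ∷ qs)
listCost-start-<⊎continues x y [] σ = inj₁ (s≤s z≤n)
listCost-start-<⊎continues x y (q ∷ ps) [] = inj₁ (s≤s z≤n)
listCost-start-<⊎continues x y (q ∷ ps) (r ∷ σ) with q ≟ y
... | yes refl = inj₂ (ps , refl)
... | no q≢y rewrite migCost-≢ (λ y≡q → q≢y (sym y≡q)) =
  inj₁ (s≤s (+-monoˡ-≤ (listCost q ps σ) (+-monoˡ-≤ (serveCost q r) (migCost≤1 x q))))

listCost-stay : (y : Fin n) (r : Request n) (ps : List (Fin n)) (σ : List (Request n)) →
                listCost y (y ∷ ps) (r ∷ σ) ≤ 2 + listCost y ps σ
listCost-stay y r ps σ rewrite migCost-refl y = +-monoˡ-≤ (listCost y ps σ) (serveCost≤2 y r)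

listCost-switch : {x y : Fin n} {r : Request n} → y ≢ x → serveCost x r ≡ 2 →
                  (ps : List (Fin n)) (σ : List (Request n)) →
                  listCost y (x ∷ ps) (r ∷ σ) ≡ 2 + (1 + listCost x ps σ)
listCost-switch y≢x far ps σ rewrite migCost-≢ y≢x | far = refl

listCost-stay-vs-switch : {x y : Fin n} {r : Request n} → y ≢ x → serveCost x r ≡ 2 →
                          (qs : List (Fin n)) (τ : List (Request n)) →
                          listCost y (y ∷ qs) (r ∷ τ) < listCost y (x ∷ qs) (r ∷ τ)
                          ⊎ (listCost y (y ∷ qs) (r ∷ τ) ≤ listCost y (x ∷ qs) (r ∷ τ)
                             × Σ (List (Fin n)) (λ qs′ → qs ≡ x ∷ qs′))
listCost-stay-vs-switch {x = x} {y} {r} y≢x far qs τ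
  rewrite listCost-switch {r = r} y≢x far qs τ
  with listCost-start-<⊎continues y x qs τ
... | inj₁ lt = inj₁ (≤-<-trans (listCost-stay y r qs τ) (+-monoʳ-< 2 lt))
... | inj₂ continues =
  inj₂ (≤-trans (listCost-stay y r qs τ) (+-monoʳ-≤ 2 (listCost-start-≤ y x qs τ)) , continues)

runsFrom-≡ : (x : Fin n) (k : ℕ) (ps : List (Fin n)) → runsFrom x k (x ∷ ps) ≡ runsFrom x (suc k) ps
runsFrom-≡ x k ps with x ≟ x
... | yes _ = refl
... | no x≢x = ⊥-elim (x≢x refl)

runsFrom-≢ : {x y : Fin n} → x ≢ y → (k : ℕ) (ps : List (Fin n)) →
             runsFrom x k (y ∷ ps) ≡ k ∷ runsFrom y 1 ps
runsFrom-≢ {x = x} {y} x≢y k ps with x ≟ y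
... | yes x≡y = ⊥-elim (x≢y x≡y)
... | no _ = refl

runsFrom-++-∷ : (x : Fin n) (k : ℕ) (ps : List (Fin n)) (y : Fin n) →
                ∃₂ λ ks c → ∀ qs → runsFrom x k (ps ++ y ∷ qs) ≡ ks ++ runsFrom y c qs
runsFrom-++-∷ x k [] y with x ≟ y
... | yes refl = [] , suc k , λ qs → refl
... | no _ = [ k ] , 1 , λ qs → refl
runsFrom-++-∷ x k (p ∷ ps) y with x ≟ p
... | yes refl = runsFrom-++-∷ x (suc k) ps y
... | no _ = let ks , c , runs≡ = runsFrom-++-∷ p 1 ps y in
  k ∷ ks , c , λ qs → cong (k ∷_) (runs≡ qs)

runs-++-∷ : (ps : List (Fin n)) (y : Fin n) →
            ∃₂ λ ks c → ∀ qs → runs (ps ++ y ∷ qs) ≡ ks ++ runsFrom y c qs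
runs-++-∷ [] y = [] , 1 , λ qs → refl
runs-++-∷ (p ∷ ps) y = runsFrom-++-∷ p 1 ps y

runsFrom-+ : (x : Fin n) (ps : List (Fin n)) → ∃₂ λ d ks → ∀ k → runsFrom x k ps ≡ k + d ∷ ks
runsFrom-+ x [] = 0 , [] , λ k → cong (_∷ []) (sym (+-identityʳ k))
runsFrom-+ x (p ∷ ps) with x ≟ p
... | yes refl = let d , ks , runs≡ = runsFrom-+ x ps in
  suc d , ks , λ k → trans (runs≡ (suc k)) (cong (_∷ ks) (sym (+-suc k d)))
... | no _ = 0 , runsFrom p 1 ps , λ k → cong (_∷ runsFrom p 1 ps) (sym (+-identityʳ k))

≰lex-after-common-prefix : (ks : List ℕ) {a b : ℕ} {xs ys : List ℕ} → b < a →
                           ¬ (ks ++ a ∷ xs) ≤lex (ks ++ b ∷ ys)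
≰lex-after-common-prefix [] b<a (head< a<b) = <-asym a<b b<a
≰lex-after-common-prefix [] b<a (head≡ _) = <-irrefl refl b<a
≰lex-after-common-prefix (k ∷ ks) b<a (head< k<k) = <-irrefl refl k<k
≰lex-after-common-prefix (k ∷ ks) b<a (head≡ le) = ≰lex-after-common-prefix ks b<a le

reverse-++-∷-∷ : (ks : List A) (a b : A) (ls : List A) →
                 reverse (ks ++ a ∷ b ∷ ls) ≡ reverse ls ++ b ∷ a ∷ reverse ks
reverse-++-∷-∷ ks a b ls = trans (++-ʳ++ ks) (ʳ++-defn ls)

postpone-runs : {x y : Fin n} → y ≢ x → (ps qs : List (Fin n)) →
                ¬ reverse (runs (ps ++ y ∷ x ∷ x ∷ qs)) ≤lex reverse (runs (ps ++ y ∷ y ∷ x ∷ qs))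
postpone-runs {x = x} {y} y≢x ps qs with runs-++-∷ ps y | runsFrom-+ x qs
... | ks , c , runs≡ | d , ls , runsFrom≡ =
  λ le → ≰lex-after-common-prefix (reverse ls) ≤-refl
           (subst₂ _≤lex_ (trans (cong reverse switched) (reverse-++-∷-∷ ks c (2 + d) ls))
                          (trans (cong reverse postponed) (reverse-++-∷-∷ ks (suc c) (1 + d) ls)) le)
  where
  open ≡-Reasoning
  switched : runs (ps ++ y ∷ x ∷ x ∷ qs) ≡ ks ++ c ∷ 2 + d ∷ ls
  switched = begin
    runs (ps ++ y ∷ x ∷ x ∷ qs)     ≡⟨ runs≡ (x ∷ x ∷ qs) ⟩
    ks ++ runsFrom y c (x ∷ x ∷ qs) ≡⟨ cong (ks ++_) (runsFrom-≢ y≢x c (x ∷ qs)) ⟩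
    ks ++ c ∷ runsFrom x 1 (x ∷ qs) ≡⟨ cong (λ rs → ks ++ c ∷ rs) (runsFrom-≡ x 1 qs) ⟩
    ks ++ c ∷ runsFrom x 2 qs       ≡⟨ cong (λ rs → ks ++ c ∷ rs) (runsFrom≡ 2) ⟩
    ks ++ c ∷ 2 + d ∷ ls            ∎
  postponed : runs (ps ++ y ∷ y ∷ x ∷ qs) ≡ ks ++ suc c ∷ 1 + d ∷ ls
  postponed = begin
    runs (ps ++ y ∷ y ∷ x ∷ qs)       ≡⟨ runs≡ (y ∷ x ∷ qs) ⟩
    ks ++ runsFrom y c (y ∷ x ∷ qs)   ≡⟨ cong (ks ++_) (runsFrom-≡ y c (x ∷ qs)) ⟩
    ks ++ runsFrom y (suc c) (x ∷ qs) ≡⟨ cong (ks ++_) (runsFrom-≢ y≢x (suc c) qs) ⟩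
    ks ++ suc c ∷ runsFrom x 1 qs     ≡⟨ cong (λ rs → ks ++ suc c ∷ rs) (runsFrom≡ 1) ⟩
    ks ++ suc c ∷ 1 + d ∷ ls          ∎

postpone-switch-++ : (init : Fin n) {ps : List (Fin n)} {σ : List (Request n)} → length ps ≡ length σ →
                     {x y : Fin n} {s r : Request n} → y ≢ x → serveCost x r ≡ 2 →
                     (qs : List (Fin n)) (τ : List (Request n)) →
                     let switched  = listCost init (ps ++ y ∷ x ∷ qs) (σ ++ s ∷ r ∷ τ)
                         postponed = listCost init (ps ++ y ∷ y ∷ qs) (σ ++ s ∷ r ∷ τ)
                     in postponed < switched
                        ⊎ (postponed ≤ switched
                           × ¬ reverse (runs (ps ++ y ∷ x ∷ qs)) ≤lex reverse (runs (ps ++ y ∷ y ∷ qs)))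
postpone-switch-++ init {ps} {σ} eq {x} {y} {s} {r} y≢x far qs τ =
  ⊎-map (λ stay<switch → subst₂ _<_ (split (y ∷ qs)) (split (x ∷ qs))
                                     (+-monoʳ-< prefix stay<switch))
        (×-map (λ stay≤switch → subst₂ _≤_ (split (y ∷ qs)) (split (x ∷ qs))
                                         (+-monoʳ-≤ prefix stay≤switch))
               (λ { (qs′ , refl) → postpone-runs y≢x ps qs′ }))
        (listCost-stay-vs-switch {r = r} y≢x far qs τ)
  where
  prefix : ℕ
  prefix = listCost init (ps ++ [ y ]) (σ ++ [ s ])
  split : ∀ zs → prefix + listCost y zs (r ∷ τ) ≡ listCost init (ps ++ y ∷ zs) (σ ++ s ∷ r ∷ τ)
  split zs = sym (listCost-++-∷ init {ps} {σ} eq y s zs (r ∷ τ))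

-- before v k and after v k are the entries strictly before position k and strictly after position k + 1.
before : Vec A (suc m) → Fin m → List A
before (a ∷ v) zero = []
before (a ∷ v) (suc k) = a ∷ before v k

after : Vec A (suc m) → Fin m → List A
after (a ∷ v) (suc k) = after v k
after (a ∷ b ∷ v) zero = toList v

length-before : (v : Vec A (suc m)) (k : Fin m) → length (before v k) ≡ toℕ k
length-before (a ∷ v) zero = refl
length-before (a ∷ v) (suc k) = cong suc (length-before v k)

toList-[]≔ : (v : Vec A (suc m)) (k : Fin m) (b : A) →
             toList (v [ suc k ]≔ b) ≡ before v k ++ lookup v (inject₁ k) ∷ b ∷ after v k
toList-[]≔ (a ∷ v) (suc k) b = cong (a ∷_) (toList-[]≔ v k b)
toList-[]≔ (a ∷ a′ ∷ v) zero b = refl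

toList-window : (v : Vec A (suc m)) (k : Fin m) →
                toList v ≡ before v k ++ lookup v (inject₁ k) ∷ lookup v (suc k) ∷ after v k
toList-window v k = trans (cong toList (sym ([]≔-lookup v (suc k)))) (toList-[]≔ v k (lookup v (suc k)))

postpone-switch : (init : Fin n) (σ : Vec (Request n) (suc m)) (ps : Vec (Fin n) (suc m)) (k : Fin m) →
                  lookup ps (inject₁ k) ≢ lookup ps (suc k) →
                  serveCost (lookup ps (suc k)) (lookup σ (suc k)) ≡ 2 →
                  let qs = ps [ suc k ]≔ lookup ps (inject₁ k) in
                  cost init qs σ < cost init ps σ
                  ⊎ (cost init qs σ ≤ cost init ps σ
                     × ¬ reverse (phaseLengths ps) ≤lex reverse (phaseLengths qs))
postpone-switch init σ ps k y≢x far
  rewrite cost≡listCost init ps σ | cost≡listCost init (ps [ suc k ]≔ lookup ps (inject₁ k)) σ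
        | toList-[]≔ ps k (lookup ps (inject₁ k)) | toList-window ps k | toList-window σ k =
  postpone-switch-++ init {before ps k} {before σ k} (trans (length-before ps k) (sym (length-before σ k)))
                     y≢x far (after ps k) (after σ k)

OPTstar-switch-not-far : (init : Fin n) (σ : Vec (Request n) (suc m)) (ps : Vec (Fin n) (suc m)) →
                         IsOPTstar init σ ps → (k : Fin m) → lookup ps (inject₁ k) ≢ lookup ps (suc k) →
                         serveCost (lookup ps (suc k)) (lookup σ (suc k)) ≢ 2
OPTstar-switch-not-far {n} {m} init σ ps (optimal , minimal) k y≢x far =
  [ (λ cheaper → <⇒≱ cheaper (optimal postponed))
  , (λ { (noWorse , lexSmaller) →
          lexSmaller (minimal postponed (λ qs → ≤-trans noWorse (optimal qs))) })
  ]′ (postpone-switch init σ ps k y≢x far)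
  where
  postponed : Vec (Fin n) (suc m)
  postponed = ps [ suc k ]≔ lookup ps (inject₁ k)

lemma1 : ∀ {n m} (init : Fin n) (σ : Vec (Request n) m) (opt : Vec (Fin n) m)
    → IsOPTstar init σ opt
    → (i j : Fin m) → IsPhase opt i j
    → toℕ i ≢ 0
    → lookup opt i ∈ʳ lookup σ i
lemma1 init σ opt _ zero _ _ i≢0 = ⊥-elim (i≢0 refl)
lemma1 init σ opt isOPTstar (suc k) _ (_ , _ , pivotChanges , _) _
  with ∈ʳ⊎serveCost≡2 (lookup opt (suc k)) (lookup σ (suc k))
... | inj₁ x∈σᵢ = x∈σᵢ
... | inj₂ far = ⊥-elim (OPTstar-switch-not-far init σ opt isOPTstar k
                           (pivotChanges (inject₁ k) (cong suc (toℕ-inject₁ k))) far)
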